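{- The refined skew characteristic polynomial satisfies the $4$-term relations for graphs: for every finite simple graph $G$ and every pair of distinct vertices $a,b\in V(G)$, $$\overline{Q}_G-\overline{Q}_{G'_{ab}}=\overline{Q}_{\widetilde G_{ab}}-\overline{Q}_{\widetilde G'_{ab}}.$$
   Context: For a finite simple graph $G$ and $U\subseteq V(G)$, $G(U)$ is the induced subgraph and $A_{G(U)}$ its adjacency matrix over $\mathbb{F}_2$ (empty, of corank $0$, if $U=\emptyset$). The refined skew characteristic polynomial is $\overline{Q}_G(u,v)=\sum_{U\subseteq V(G)}u^{|V(G)|-|U|}v^{\operatorname{corank}A_{G(U)}}$, corank taken over $\mathbb{F}_2$. For distinct vertices $a,b$: $G'_{ab}$ is obtained from $G$ by deleting the edge $ab$ if present and adding it otherwise; $\widetilde G_{ab}$ is obtained from $G$ by switching, for every vertex $c\notin\{a,b\}$ adjacent to $b$, the adjacency between $c$ and $a$; $\widetilde G'_{ab}=(\widetilde G_{ab})'_{ab}$. -}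

module Defs where

import Data.Bool
open import Data.Bool using (Bool; true; false; not; _∧_; _∨_; _xor_; if_then_else_)
open import Data.Nat using (ℕ; zero; suc; _∸_; _≡ᵇ_)
open import Data.Fin using (Fin; zero; suc)
open import Data.Fin.Properties using (_≟_)
open import Data.List using (List; []; _∷_; length; filter; map; _++_; allFin)
open import Data.Vec using (Vec; fromList; lookup)
open import Data.Integer using (ℤ; +_)
open import Relation.Nullary.Decidable using (⌊_⌋)
open import Relation.Binary.PropositionalEquality using (_≡_)

Adj : ℕ → Set
Adj n = Fin n → Fin n → Bool

record IsSimple {n : ℕ} (G : Adj n) : Set where
  field
    symm    : ∀ x y → G x y ≡ G y x
    loopless : ∀ x → G x x ≡ false

_==_ : ∀ {n} → Fin n → Fin n → Bool
x == y = ⌊ x ≟ y ⌋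

-- G'_{ab}: toggle the edge ab
toggle : ∀ {n} → Fin n → Fin n → Adj n → Adj n
toggle a b G x y =
  if ((x == a) ∧ (y == b)) ∨ ((x == b) ∧ (y == a)) then not (G x y) else G x y

-- G~_{ab}: for every c ∉ {a,b} adjacent to b, switch the adjacency c–a
-- condition "x is such a c" for a vertex x
isSwitched : ∀ {n} → Fin n → Fin n → Adj n → Fin n → Bool
isSwitched a b G c = not (c == a) ∧ not (c == b) ∧ G c b

slide : ∀ {n} → Fin n → Fin n → Adj n → Adj n
slide a b G x y =
  if ((x == a) ∧ isSwitched a b G y) ∨ ((y == a) ∧ isSwitched a b G x)
  then not (G x y) else G x y

slideToggle : ∀ {n} → Fin n → Fin n → Adj n → Adj n
slideToggle a b G = toggle a b (slide a b G)

-- Rank over F₂ (Bool with xor) by Gaussian elimination.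
-- A matrix with m columns is a list of rows, each row a function Fin m → Bool.

Row : ℕ → Set
Row m = Fin m → Bool

data PivotSearch (m : ℕ) : Set where
  noPivot : PivotSearch m
  pivot   : Row (suc m) → List (Row (suc m)) → PivotSearch m

tailRow : ∀ {m} → Row (suc m) → Row m
tailRow r i = r (suc i)

addRow : ∀ {m} → Row m → Row m → Row m
addRow r p i = r i xor p i

findPivot : ∀ {m} → List (Row (suc m)) → List (Row (suc m)) → PivotSearch m
findPivot acc [] = noPivot
findPivot acc (r ∷ rs) =
  if r zero then pivot r (acc ++ rs) else findPivot (acc ++ (r ∷ [])) rs

reduce : ∀ {m} → Row (suc m) → Row (suc m) → Row (suc m)
reduce p r = if r zero then addRow r p else r

rank : (m : ℕ) → List (Row m) → ℕ
rank zero    rows = 0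
rank (suc m) rows with findPivot [] rows
... | noPivot      = rank m (map tailRow rows)
... | pivot p rest = suc (rank m (map (λ r → tailRow (reduce p r)) rest))

corank : (k : ℕ) → (Fin k → Fin k → Bool) → ℕ
corank k A = k ∸ rank k (map A (allFin k))

subsets : (n : ℕ) → List (Fin n → Bool)
subsets zero    = (λ ()) ∷ []
subsets (suc n) = map (λ U → extend false U) (subsets n) ++ map (λ U → extend true U) (subsets n)
  where
  extend : Bool → (Fin n → Bool) → Fin (suc n) → Bool
  extend b U zero    = b
  extend b U (suc i) = U i

elems : ∀ {n} → (Fin n → Bool) → List (Fin n)
elems {n} U = filter (λ x → U x Data.Bool.≟ true) (allFin n)

inducedMatrix : ∀ {n} → Adj n → (U : Fin n → Bool) →
                Fin (length (elems U)) → Fin (length (elems U)) → Bool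
inducedMatrix G U i j = G (lookup (fromList (elems U)) i) (lookup (fromList (elems U)) j)

corankInduced : ∀ {n} → Adj n → (Fin n → Bool) → ℕ
corankInduced G U = corank (length (elems U)) (inducedMatrix G U)

-- A polynomial in ℤ[u,v], represented by its coefficient function:
-- Poly i j = coefficient of u^i v^j
Poly : Set
Poly = ℕ → ℕ → ℤ

-- Q̄_G(u,v) = Σ_{U ⊆ V(G)} u^{|V(G)|-|U|} v^{corank A_{G(U)}}
-- coefficient of u^i v^j = number of U with n - |U| = i and corank = j
Qbar : ∀ {n} → Adj n → Poly
Qbar {n} G i j =
  + length (filter (λ U → ((n ∸ length (elems U)) ≡ᵇ i) ∧ (corankInduced G U ≡ᵇ j) Data.Bool.≟ true)
                   (subsets n))

{-# OPTIONS --safe #-}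
-- The relation holds subset by subset. If U misses a or b, toggling ab does not change the
-- induced subgraphs, so G(U) and G'(U), as well as G̃(U) and G̃'(U), have equal coranks. If U
-- contains a and b, the adjacency matrix of G̃(U) is P A Pᵀ, where A is that of G(U) and P adds
-- row b to row a (over 𝔽₂ the diagonal stays zero), so G(U) and G̃(U) have equal coranks; as
-- sliding commutes with toggling ab, so do G'(U) and G̃'(U). For the rank itself, computed by
-- Gaussian elimination, we show that it depends only on the row space and does not increase
-- under linear maps of the rows, which gives invariance under row and column operations.
module Submission where

open import Defs
open import Data.Bool using (Bool; true; false; not; _∧_; _∨_; _xor_; if_then_else_)
import Data.Bool.Properties as Boolᵖ
open import Data.Bool.Properties
  using (∧-comm; ∨-comm; ∧-zeroʳ; ∧-identityʳ; ∨-identityʳ; xor-assoc; xor-comm; xor-same; xor-identityʳ)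
open import Data.Bool.Solver using (module xor-∧-Solver)
open import Data.Nat using (ℕ; zero; suc; _+_; _∸_; _≤_; z≤n; s≤s; _≡ᵇ_)
open import Data.Nat.Properties using (+-comm; +-commutativeSemigroup; ≤-antisym; ≤-trans; ≤-reflexive; m≤n⇒m≤1+n; module ≤-Reasoning)
open import Data.Fin using (Fin; zero; suc)
open import Data.Fin.Properties using (_≟_)
open import Data.Integer using (+_; _-_; _⊖_)
open import Data.Integer.Properties using (m-n≡m⊖n; +-cancelˡ-⊖)
open import Algebra.Properties.CommutativeSemigroup +-commutativeSemigroup using (interchange)
open import Data.List using (List; []; _∷_; length; map; filter; allFin; _++_)
import Data.List as List
open import Data.List.Properties using (length-map; map-∘; ++-assoc; length-++-sucʳ)
open import Data.List.Membership.Propositional using (_∈_)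
open import Data.List.Membership.Propositional.Properties
  using (∈-map⁺; ∈-map⁻; ∈-++⁺ˡ; ∈-++⁺ʳ; ∈-++⁻; ∈-allFin; ∈-filter⁺; ∈-filter⁻; ∈-lookup)
open import Data.List.Relation.Unary.Any using (here; there; index)
open import Data.List.Relation.Unary.Any.Properties using (lookup-index)
open import Data.Vec using (fromList; lookup)
open import Data.Product using (Σ-syntax; _×_; _,_; proj₂) renaming (map to ×-map)
open import Data.Sum using (_⊎_; inj₁; inj₂) renaming (map to ⊎-map)
open import Relation.Nullary using (¬_; yes; no; contradiction)
open import Relation.Nullary.Decidable using (dec-false; isYes≗does)
open import Relation.Binary.PropositionalEquality
  using (_≡_; _≢_; refl; sym; trans; cong; cong₂; subst; module ≡-Reasoning)

xor-cancelʳ : ∀ x y → (x xor y) xor y ≡ x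
xor-cancelʳ x y = trans (xor-assoc x y y) (trans (cong (x xor_) (xor-same y)) (xor-identityʳ x))

if-not≡xor : ∀ c g → (if c then not g else g) ≡ g xor c
if-not≡xor true  g = sym (xor-comm g true)
if-not≡xor false g = sym (xor-identityʳ g)

if-not-comm : ∀ c d g →
  (if c then not (if d then not g else g) else (if d then not g else g))
  ≡ (if d then not (if c then not g else g) else (if c then not g else g))
if-not-comm true  true  g = refl
if-not-comm true  false g = refl
if-not-comm false true  g = refl
if-not-comm false false g = refl

-- Linear algebra over 𝔽₂

infix 4 _≐_ _⊑_

_≐_ : ∀ {m} → Row m → Row m → Set
v ≐ w = ∀ i → v i ≡ w i

zeroRow : ∀ {m} → Row m
zeroRow _ = false

data Span {m} (rs : List (Row m)) : Row m → Set where
  zero-∈ : ∀ {v} → v ≐ zeroRow → Span rs v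
  add-∈  : ∀ {r w v} → r ∈ rs → Span rs w → v ≐ addRow r w → Span rs v

_⊑_ : ∀ {m} → List (Row m) → List (Row m) → Set
rs ⊑ rs′ = ∀ {r} → r ∈ rs → Span rs′ r

module _ {m : ℕ} {rs : List (Row m)} where

  Span-resp-≐ : ∀ {v w} → v ≐ w → Span rs v → Span rs w
  Span-resp-≐ v≐w (zero-∈ v≐0)       = zero-∈ (λ i → trans (sym (v≐w i)) (v≐0 i))
  Span-resp-≐ v≐w (add-∈ r∈ s v≐r+w) = add-∈ r∈ s (λ i → trans (sym (v≐w i)) (v≐r+w i))

  ∈⇒Span : ∀ {r} → r ∈ rs → Span rs r
  ∈⇒Span r∈ = add-∈ r∈ (zero-∈ (λ _ → refl)) (λ i → sym (xor-identityʳ _))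

  Span-addRow : ∀ {u v w} → Span rs v → Span rs w → u ≐ addRow v w → Span rs u
  Span-addRow {w = w} (zero-∈ v≐0) sw u≐v+w =
    Span-resp-≐ (λ i → sym (trans (u≐v+w i) (cong (_xor w i) (v≐0 i)))) sw
  Span-addRow {w = w} (add-∈ {r} {w′} r∈ sw′ v≐r+w′) sw u≐v+w =
    add-∈ r∈ (Span-addRow sw′ sw (λ _ → refl))
      (λ i → trans (u≐v+w i) (trans (cong (_xor w i) (v≐r+w′ i)) (xor-assoc (r i) (w′ i) (w i))))

  Span-scale : ∀ {v} (c : Bool) → Span rs v → Span rs (λ j → c ∧ v j)
  Span-scale true  s = s
  Span-scale false s = zero-∈ (λ _ → refl)

Span-⊑ : ∀ {m} {rs rs′ : List (Row m)} → rs ⊑ rs′ → ∀ {v} → Span rs v → Span rs′ v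
Span-⊑ rs⊑rs′ (zero-∈ v≐0)       = zero-∈ v≐0
Span-⊑ rs⊑rs′ (add-∈ r∈ s v≐r+w) = Span-addRow (rs⊑rs′ r∈) (Span-⊑ rs⊑rs′ s) v≐r+w

Span-∷ : ∀ {m} {r : Row m} {rs v} → Span rs v → Span (r ∷ rs) v
Span-∷ = Span-⊑ (λ r∈ → ∈⇒Span (there r∈))

Span-drop-zero : ∀ {m} {r : Row m} {rs v} → r ≐ zeroRow → Span (r ∷ rs) v → Span rs v
Span-drop-zero {rs = rs} r≐0 = Span-⊑ drop
  where
  drop : _ ∷ rs ⊑ rs
  drop (here refl) = zero-∈ r≐0
  drop (there r∈)  = ∈⇒Span r∈

Span-leading-zero : ∀ {m} {rs : List (Row (suc m))} → (∀ {r} → r ∈ rs → r zero ≡ false) →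
                    ∀ {v} → Span rs v → v zero ≡ false
Span-leading-zero lead (zero-∈ v≐0) = v≐0 zero
Span-leading-zero lead (add-∈ r∈ s v≐r+w)
  rewrite v≐r+w zero | lead r∈ | Span-leading-zero lead s = refl

record IsLinear {m m′} (f : Row m → Row m′) : Set where
  field
    resp-≐ : ∀ {v w} → v ≐ w → f v ≐ f w
    homo   : ∀ v w → f (addRow v w) ≐ addRow (f v) (f w)
    0-homo : f zeroRow ≐ zeroRow

open IsLinear

Span-map : ∀ {m m′} {f : Row m → Row m′} → IsLinear f → ∀ {rs v} → Span rs v → Span (map f rs) (f v)
Span-map L (zero-∈ v≐0) = zero-∈ (λ i → trans (resp-≐ L v≐0 i) (0-homo L i))
Span-map L (add-∈ {r} {w} r∈ s v≐r+w) =
  add-∈ (∈-map⁺ _ r∈) (Span-map L s) (λ i → trans (resp-≐ L v≐r+w i) (homo L r w i))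

IsLinear-≗ : ∀ {m m′} {f g : Row m → Row m′} → (∀ v → f v ≐ g v) → IsLinear g → IsLinear f
IsLinear-≗ f≐g L = record
  { resp-≐ = λ {v} {w} v≐w i → trans (f≐g v i) (trans (resp-≐ L v≐w i) (sym (f≐g w i)))
  ; homo   = λ v w i → trans (f≐g _ i) (trans (homo L v w i) (sym (cong₂ _xor_ (f≐g v i) (f≐g w i))))
  ; 0-homo = λ i → trans (f≐g _ i) (0-homo L i)
  }

IsLinear-∘ : ∀ {m m′ m″} {g : Row m′ → Row m″} {f : Row m → Row m′} →
             IsLinear g → IsLinear f → IsLinear (λ v → g (f v))
IsLinear-∘ Lg Lf = record
  { resp-≐ = λ v≐w → resp-≐ Lg (resp-≐ Lf v≐w)
  ; homo   = λ v w i → trans (resp-≐ Lg (homo Lf v w) i) (homo Lg _ _ i)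
  ; 0-homo = λ i → trans (resp-≐ Lg (0-homo Lf) i) (0-homo Lg i)
  }

tailRow-linear : ∀ {m} → IsLinear (tailRow {m})
tailRow-linear = record { resp-≐ = λ v≐w i → v≐w (suc i) ; homo = λ _ _ _ → refl ; 0-homo = λ _ → refl }

transvect : ∀ {m} → Fin m → Row m → Row m → Row m
transvect β u v j = v j xor (v β ∧ u j)

transvect-linear : ∀ {m} (β : Fin m) u → IsLinear (transvect β u)
transvect-linear β u = record
  { resp-≐ = λ v≐w j → cong₂ (λ x y → x xor (y ∧ u j)) (v≐w j) (v≐w β)
  ; homo   = λ v w j → distrib (v j) (w j) (u j) (v β) (w β)
  ; 0-homo = λ j → refl
  }
  where
  open xor-∧-Solver
  distrib : ∀ vj wj uj vβ wβ →
            (vj xor wj) xor ((vβ xor wβ) ∧ uj) ≡ (vj xor (vβ ∧ uj)) xor (wj xor (wβ ∧ uj))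
  distrib = solve 5 (λ vj wj uj vβ wβ →
    (vj :+ wj) :+ ((vβ :+ wβ) :* uj) := (vj :+ (vβ :* uj)) :+ (wj :+ (wβ :* uj))) refl

transvect-involutive : ∀ {m} {β : Fin m} {u} → u β ≡ false → ∀ v → transvect β u (transvect β u v) ≐ v
transvect-involutive {β = β} {u} uβ v j
  rewrite uβ | ∧-zeroʳ (v β) | xor-identityʳ (v β) = xor-cancelʳ (v j) (v β ∧ u j)

-- Gaussian elimination

findPivot-noPivot : ∀ {m} (acc rs : List (Row (suc m))) → findPivot acc rs ≡ noPivot →
                    ∀ {r} → r ∈ rs → r zero ≡ false
findPivot-noPivot acc (x ∷ rs) eq r∈ with x zero in x₀
findPivot-noPivot acc (x ∷ rs) () r∈          | true
findPivot-noPivot acc (x ∷ rs) eq (here refl) | false = x₀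
findPivot-noPivot acc (x ∷ rs) eq (there r∈)  | false = findPivot-noPivot (acc ++ x ∷ []) rs eq r∈

record IsPivotSplit {m} (rs : List (Row (suc m))) (p : Row (suc m)) (rest : List (Row (suc m))) : Set where
  field
    leading : p zero ≡ true
    p∈      : p ∈ rs
    split   : ∀ {r} → r ∈ rs → r ≡ p ⊎ r ∈ rest
    rest⊆   : ∀ {r} → r ∈ rest → r ∈ rs
    length≡ : suc (length rest) ≡ length rs

findPivot-pivot : ∀ {m} (acc rs : List (Row (suc m))) {p rest} → findPivot acc rs ≡ pivot p rest →
                  IsPivotSplit (acc ++ rs) p rest
findPivot-pivot acc (x ∷ rs) eq with x zero in x₀
findPivot-pivot acc (x ∷ rs) refl | true = record
  { leading = x₀
  ; p∈      = ∈-++⁺ʳ acc (here refl)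
  ; split   = split
  ; rest⊆   = rest⊆
  ; length≡ = sym (length-++-sucʳ acc x rs)
  }
  where
  split : ∀ {r} → r ∈ acc ++ x ∷ rs → r ≡ x ⊎ r ∈ acc ++ rs
  split r∈ with ∈-++⁻ acc r∈
  ... | inj₁ r∈acc         = inj₂ (∈-++⁺ˡ r∈acc)
  ... | inj₂ (here refl)   = inj₁ refl
  ... | inj₂ (there r∈rs)  = inj₂ (∈-++⁺ʳ acc r∈rs)
  rest⊆ : ∀ {r} → r ∈ acc ++ rs → r ∈ acc ++ x ∷ rs
  rest⊆ r∈ with ∈-++⁻ acc r∈
  ... | inj₁ r∈acc = ∈-++⁺ˡ r∈acc
  ... | inj₂ r∈rs  = ∈-++⁺ʳ acc (there r∈rs)
findPivot-pivot acc (x ∷ rs) {p} {rest} eq | false =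
  subst (λ xs → IsPivotSplit xs p rest) (++-assoc acc (x ∷ []) rs) (findPivot-pivot (acc ++ x ∷ []) rs eq)

pivot-⊑ : ∀ {m} {rs : List (Row (suc m))} {p rest} → IsPivotSplit rs p rest → rs ⊑ p ∷ rest
pivot-⊑ P r∈ with IsPivotSplit.split P r∈
... | inj₁ refl     = ∈⇒Span (here refl)
... | inj₂ r∈rest   = ∈⇒Span (there r∈rest)

eliminate : ∀ {m} → Row (suc m) → Row (suc m) → Row m
eliminate p r = tailRow (reduce p r)

reduce≐transvect : ∀ {m} (p r : Row (suc m)) → reduce p r ≐ transvect zero p r
reduce≐transvect p r i with r zero
... | true  = refl
... | false = sym (xor-identityʳ (r i))

eliminate-linear : ∀ {m} (p : Row (suc m)) → IsLinear (eliminate p)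
eliminate-linear p =
  IsLinear-≗ (λ r i → reduce≐transvect p r (suc i)) (IsLinear-∘ tailRow-linear (transvect-linear zero p))

reduce-leading : ∀ {m} {p : Row (suc m)} r → p zero ≡ true → reduce p r zero ≡ false
reduce-leading {p = p} r p₀ with r zero in r₀
... | true  rewrite r₀ | p₀ = refl
... | false = r₀

reduce-Span : ∀ {m} {rs : List (Row (suc m))} {p r} → p ∈ rs → r ∈ rs → Span rs (reduce p r)
reduce-Span {r = r} p∈ r∈ with r zero
... | true  = Span-addRow (∈⇒Span r∈) (∈⇒Span p∈) (λ _ → refl)
... | false = ∈⇒Span r∈

Span-eliminate : ∀ {m} {p : Row (suc m)} {rest v} → p zero ≡ true → v zero ≡ false →
                 Span (p ∷ rest) v → Span (map (eliminate p) rest) (tailRow v)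
Span-eliminate {p = p} {v = v} p₀ v₀ s =
  Span-resp-≐ eliminate-v (Span-drop-zero eliminate-p (Span-map (eliminate-linear p) s))
  where
  eliminate-p : eliminate p p ≐ zeroRow
  eliminate-p i rewrite p₀ = xor-same (p (suc i))
  eliminate-v : eliminate p v ≐ tailRow v
  eliminate-v i rewrite v₀ = refl

-- The induction runs the elimination on both sides; span inclusion survives eliminating the pivots.
rank-mono : ∀ m {rs rs′ : List (Row m)} → rs ⊑ rs′ → rank m rs ≤ rank m rs′
rank-mono zero _ = z≤n
rank-mono (suc m) {rs} {rs′} rs⊑rs′ with findPivot [] rs in eq | findPivot [] rs′ in eq′
... | noPivot | noPivot = rank-mono m tails⊑
  where
  tails⊑ : map tailRow rs ⊑ map tailRow rs′
  tails⊑ r∈ with ∈-map⁻ tailRow r∈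
  ... | r , r∈rs , refl = Span-map tailRow-linear (rs⊑rs′ r∈rs)
... | noPivot | pivot p′ rest′ = m≤n⇒m≤1+n (rank-mono m tails⊑)
  where
  P′ = findPivot-pivot [] rs′ eq′
  tails⊑ : map tailRow rs ⊑ map (eliminate p′) rest′
  tails⊑ r∈ with ∈-map⁻ tailRow r∈
  ... | r , r∈rs , refl = Span-eliminate (IsPivotSplit.leading P′) (findPivot-noPivot [] rs eq r∈rs)
                            (Span-⊑ (pivot-⊑ P′) (rs⊑rs′ r∈rs))
... | pivot p rest | noPivot
  with P ← findPivot-pivot [] rs eq
  with () ← trans (sym (IsPivotSplit.leading P))
                  (Span-leading-zero (findPivot-noPivot [] rs′ eq′) (rs⊑rs′ (IsPivotSplit.p∈ P)))
... | pivot p rest | pivot p′ rest′ = s≤s (rank-mono m eliminated⊑)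
  where
  P  = findPivot-pivot [] rs eq
  P′ = findPivot-pivot [] rs′ eq′
  eliminated⊑ : map (eliminate p) rest ⊑ map (eliminate p′) rest′
  eliminated⊑ r∈ with ∈-map⁻ (eliminate p) r∈
  ... | r , r∈rest , refl =
    Span-eliminate (IsPivotSplit.leading P′) (reduce-leading r (IsPivotSplit.leading P))
      (Span-⊑ (pivot-⊑ P′) (Span-⊑ rs⊑rs′ (reduce-Span (IsPivotSplit.p∈ P) (IsPivotSplit.rest⊆ P r∈rest))))

rank≤length : ∀ m (rs : List (Row m)) → rank m rs ≤ length rs
rank≤length zero    rs = z≤n
rank≤length (suc m) rs with findPivot [] rs in eq
... | noPivot = ≤-trans (rank≤length m (map tailRow rs)) (≤-reflexive (length-map tailRow rs))
... | pivot p rest =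
  ≤-trans (s≤s (≤-trans (rank≤length m (map (eliminate p) rest)) (≤-reflexive (length-map (eliminate p) rest))))
          (≤-reflexive (IsPivotSplit.length≡ (findPivot-pivot [] rs eq)))

consZero : ∀ {m} → Row m → Row (suc m)
consZero v zero    = false
consZero v (suc i) = v i

consZero-linear : ∀ {m} → IsLinear (consZero {m})
consZero-linear = record { resp-≐ = resp ; homo = homo′ ; 0-homo = zero-homo }
  where
  resp : ∀ {v w} → v ≐ w → consZero v ≐ consZero w
  resp v≐w zero    = refl
  resp v≐w (suc i) = v≐w i
  homo′ : ∀ v w → consZero (addRow v w) ≐ addRow (consZero v) (consZero w)
  homo′ v w zero    = refl
  homo′ v w (suc i) = refl
  zero-homo : consZero zeroRow ≐ zeroRow
  zero-homo zero    = refl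
  zero-homo (suc i) = refl

consZero-tailRow : ∀ {m} {v : Row (suc m)} → v zero ≡ false → consZero (tailRow v) ≐ v
consZero-tailRow v₀ zero    = sym v₀
consZero-tailRow v₀ (suc i) = refl

reduce-cancel : ∀ {m} (p r : Row (suc m)) → r ≐ addRow (reduce p r) (λ j → r zero ∧ p j)
reduce-cancel p r j =
  sym (trans (cong (_xor (r zero ∧ p j)) (reduce≐transvect p r j)) (xor-cancelʳ (r j) (r zero ∧ p j)))

rank-spanning : ∀ m (rs : List (Row m)) → Σ[ bs ∈ List (Row m) ] length bs ≡ rank m rs × rs ⊑ bs
rank-spanning zero    rs = [] , refl , λ _ → zero-∈ (λ ())
rank-spanning (suc m) rs with findPivot [] rs in eq
... | noPivot with rank-spanning m (map tailRow rs)
...   | bs , |bs| , tails⊑bs =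
  map consZero bs , trans (length-map consZero bs) |bs| , rs⊑
  where
  rs⊑ : rs ⊑ map consZero bs
  rs⊑ r∈ = Span-resp-≐ (consZero-tailRow (findPivot-noPivot [] rs eq r∈))
                       (Span-map consZero-linear (tails⊑bs (∈-map⁺ tailRow r∈)))
rank-spanning (suc m) rs | pivot p rest with rank-spanning m (map (eliminate p) rest)
...   | bs , |bs| , eliminated⊑bs =
  p ∷ map consZero bs , cong suc (trans (length-map consZero bs) |bs|) , rs⊑
  where
  P = findPivot-pivot [] rs eq
  rs⊑ : rs ⊑ p ∷ map consZero bs
  rs⊑ {r} r∈ with IsPivotSplit.split P r∈
  ... | inj₁ refl   = ∈⇒Span (here refl)
  ... | inj₂ r∈rest = Span-addRow reduced (Span-scale (r zero) (∈⇒Span (here refl))) (reduce-cancel p r)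
    where
    reduced : Span (p ∷ map consZero bs) (reduce p r)
    reduced = Span-∷ (Span-resp-≐ (consZero-tailRow (reduce-leading r (IsPivotSplit.leading P)))
                                  (Span-map consZero-linear (eliminated⊑bs (∈-map⁺ (eliminate p) r∈rest))))

map-⊑ : ∀ {m m′} {f : Row m → Row m′} → IsLinear f → ∀ {rs rs′} → rs ⊑ rs′ → map f rs ⊑ map f rs′
map-⊑ {f = f} L rs⊑rs′ r∈ with ∈-map⁻ f r∈
... | r , r∈rs , refl = Span-map L (rs⊑rs′ r∈rs)

rank-map≤ : ∀ {m m′} {f : Row m → Row m′} → IsLinear f → ∀ rs → rank m′ (map f rs) ≤ rank m rs
rank-map≤ {m} {m′} {f} L rs with rank-spanning m rs
... | bs , |bs| , rs⊑bs = begin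
  rank m′ (map f rs) ≤⟨ rank-mono m′ (map-⊑ L rs⊑bs) ⟩
  rank m′ (map f bs) ≤⟨ rank≤length m′ (map f bs) ⟩
  length (map f bs)  ≡⟨ length-map f bs ⟩
  length bs          ≡⟨ |bs| ⟩
  rank m rs          ∎
  where open ≤-Reasoning

rank-cong : ∀ m {rs rs′ : List (Row m)} → rs ⊑ rs′ → rs′ ⊑ rs → rank m rs ≡ rank m rs′
rank-cong m rs⊑rs′ rs′⊑rs = ≤-antisym (rank-mono m rs⊑rs′) (rank-mono m rs′⊑rs)

rank-map-involution : ∀ {m} {f : Row m → Row m} → IsLinear f → (∀ v → f (f v) ≐ v) →
                      ∀ rs → rank m (map f rs) ≡ rank m rs
rank-map-involution {m} {f} L ff≐id rs = ≤-antisym (rank-map≤ L rs) (begin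
  rank m rs                 ≡⟨ rank-cong m rs⊑ff ff⊑rs ⟩
  rank m (map f (map f rs)) ≤⟨ rank-map≤ L (map f rs) ⟩
  rank m (map f rs)         ∎)
  where
  open ≤-Reasoning
  rs⊑ff : rs ⊑ map f (map f rs)
  rs⊑ff {r} r∈ = Span-resp-≐ (ff≐id r) (∈⇒Span (∈-map⁺ f (∈-map⁺ f r∈)))
  ff⊑rs : map f (map f rs) ⊑ rs
  ff⊑rs r∈ with ∈-map⁻ f r∈
  ... | _ , r′∈ , refl with ∈-map⁻ f r′∈
  ...   | r , r∈ , refl = Span-resp-≐ (λ i → sym (ff≐id r i)) (∈⇒Span r∈)

-- Row and column operations

rows : ∀ {k} → (Fin k → Row k) → List (Row k)
rows {k} M = map M (allFin k)

rows-⊑ : ∀ {k} {M N : Fin k → Row k} → (∀ i → M i ≐ N i) → rows M ⊑ rows N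
rows-⊑ {N = N} M≐N r∈ with ∈-map⁻ _ r∈
... | i , i∈ , refl = Span-resp-≐ (λ j → sym (M≐N i j)) (∈⇒Span (∈-map⁺ N i∈))

corank-cong : ∀ {k} {M N : Fin k → Row k} → (∀ i j → M i j ≡ N i j) → corank k M ≡ corank k N
corank-cong {k} M≐N = cong (k ∸_) (rank-cong k (rows-⊑ M≐N) (rows-⊑ (λ i j → sym (M≐N i j))))

addRows : ∀ {k} → (Fin k → Bool) → Fin k → (Fin k → Row k) → Fin k → Row k
addRows c β M i j = M i j xor (c i ∧ M β j)

addCols : ∀ {k} → (Fin k → Bool) → Fin k → (Fin k → Row k) → Fin k → Row k
addCols c β M i = transvect β c (M i)

corank-addRows : ∀ {k} {c : Fin k → Bool} {β} → c β ≡ false → ∀ M → corank k (addRows c β M) ≡ corank k M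
corank-addRows {k} {c} {β} cβ M = cong (k ∸_) (rank-cong k added⊑ ⊑added)
  where
  row-∈ : ∀ {N : Fin k → Row k} i → Span (rows N) (N i)
  row-∈ {N} i = ∈⇒Span (∈-map⁺ N (∈-allFin i))
  added⊑ : rows (addRows c β M) ⊑ rows M
  added⊑ r∈ with ∈-map⁻ _ r∈
  ... | i , _ , refl = Span-addRow (row-∈ i) (Span-scale (c i) (row-∈ β)) (λ _ → refl)
  ⊑added : rows M ⊑ rows (addRows c β M)
  ⊑added r∈ with ∈-map⁻ _ r∈
  ... | i , _ , refl = Span-addRow (row-∈ i) (Span-scale (c i) (row-∈ β)) undo
    where
    undo : M i ≐ addRow (addRows c β M i) (λ j → c i ∧ addRows c β M β j)
    undo j rewrite cβ | xor-identityʳ (M β j) = sym (xor-cancelʳ (M i j) (c i ∧ M β j))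

corank-addCols : ∀ {k} {c : Fin k → Bool} {β} → c β ≡ false → ∀ M → corank k (addCols c β M) ≡ corank k M
corank-addCols {k} {c} {β} cβ M = cong (k ∸_) (begin
  rank k (rows (addCols c β M))         ≡⟨ cong (rank k) (map-∘ (allFin k)) ⟩
  rank k (map (transvect β c) (rows M)) ≡⟨ rank-map-involution (transvect-linear β c) (transvect-involutive cβ) (rows M) ⟩
  rank k (rows M)                       ∎)
  where open ≡-Reasoning

-- Graphs and induced subgraphs

==-≢ : ∀ {n} {x y : Fin n} → x ≢ y → x == y ≡ false
==-≢ {x = x} {y} x≢y = trans (isYes≗does (x ≟ y)) (dec-false (x ≟ y) x≢y)

vertexAt : ∀ {n} (U : Fin n → Bool) → Fin (length (elems U)) → Fin n
vertexAt U = lookup (fromList (elems U))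

lookup-fromList : ∀ {A : Set} (xs : List A) i → lookup (fromList xs) i ≡ List.lookup xs i
lookup-fromList (x ∷ xs) zero    = refl
lookup-fromList (x ∷ xs) (suc i) = lookup-fromList xs i

vertexAt-∈ : ∀ {n} (U : Fin n → Bool) i → U (vertexAt U i) ≡ true
vertexAt-∈ {n} U i rewrite lookup-fromList (elems U) i =
  proj₂ (∈-filter⁻ (λ x → U x Boolᵖ.≟ true) {xs = allFin n} (∈-lookup i))

vertexAt-onto : ∀ {n} (U : Fin n → Bool) {x} → U x ≡ true → Σ[ i ∈ Fin (length (elems U)) ] vertexAt U i ≡ x
vertexAt-onto U {x} Ux = index x∈ , trans (lookup-fromList (elems U) (index x∈)) (sym (lookup-index x∈))
  where
  x∈ : x ∈ elems U
  x∈ = ∈-filter⁺ (λ x → U x Boolᵖ.≟ true) (∈-allFin x) Ux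

corankInduced-cong : ∀ {n} {H H′ : Adj n} (U : Fin n → Bool) →
                     (∀ x y → U x ≡ true → U y ≡ true → H x y ≡ H′ x y) →
                     corankInduced H U ≡ corankInduced H′ U
corankInduced-cong U H≐H′ = corank-cong (λ i j → H≐H′ _ _ (vertexAt-∈ U i) (vertexAt-∈ U j))

∈-∉-≢ : ∀ {n} {U : Fin n → Bool} {x z} → U x ≡ true → U z ≡ false → x ≢ z
∈-∉-≢ x∈U z∉U refl with trans (sym x∈U) z∉U
... | ()

module _ {n : ℕ} {a b : Fin n} where

  toggle-unchanged : ∀ {H : Adj n} {x y} → ¬ (x ≡ a × y ≡ b) → ¬ (x ≡ b × y ≡ a) → toggle a b H x y ≡ H x y
  toggle-unchanged {x = x} {y} ¬ab ¬ba with x ≟ a | y ≟ b | x ≟ b | y ≟ a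
  ... | yes x≡a | yes y≡b | _       | _       = contradiction (x≡a , y≡b) ¬ab
  ... | _       | _       | yes x≡b | yes y≡a = contradiction (x≡b , y≡a) ¬ba
  ... | no _    | _       | no _    | _       = refl
  ... | no _    | _       | yes _   | no _    = refl
  ... | yes _   | no _    | no _    | _       = refl
  ... | yes _   | no _    | yes _   | no _    = refl

  toggle-simple : a ≢ b → ∀ {G : Adj n} → IsSimple G → IsSimple (toggle a b G)
  toggle-simple a≢b {G} S = record { symm = symm′ ; loopless = loopless′ }
    where
    open IsSimple S
    symm′ : ∀ x y → toggle a b G x y ≡ toggle a b G y x
    symm′ x y = cong₂ (λ c g → if c then not g else g)
      (trans (cong₂ _∨_ (∧-comm (x == a) (y == b)) (∧-comm (x == b) (y == a)))
             (∨-comm ((y == b) ∧ (x == a)) ((y == a) ∧ (x == b))))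
      (symm x y)
    loopless′ : ∀ x → toggle a b G x x ≡ false
    loopless′ x with x ≟ a | x ≟ b
    ... | yes x≡a | yes x≡b = contradiction (trans (sym x≡a) x≡b) a≢b
    ... | yes refl | no _   = loopless a
    ... | no _    | yes refl = loopless b
    ... | no _    | no _     = loopless x

  isSwitched-toggle : ∀ G c → isSwitched a b (toggle a b G) c ≡ isSwitched a b G c
  isSwitched-toggle G c with c ≟ a | c ≟ b
  ... | yes _ | _     = refl
  ... | no _  | yes _ = refl
  ... | no _  | no _  = refl

  slide-toggle-comm : ∀ G x y → slide a b (toggle a b G) x y ≡ slideToggle a b G x y
  slide-toggle-comm G x y rewrite isSwitched-toggle G x | isSwitched-toggle G y =
    if-not-comm (((x == a) ∧ isSwitched a b G y) ∨ ((y == a) ∧ isSwitched a b G x))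
                (((x == a) ∧ (y == b)) ∨ ((x == b) ∧ (y == a))) (G x y)

  slide≡addCols∘addRows : ∀ {G : Adj n} → IsSimple G → ∀ x y →
                          slide a b G x y ≡ addCols (_== a) b (addRows (_== a) b G) x y
  slide≡addCols∘addRows {G} S x y with x ≟ a | y ≟ a
  ... | no _ | no _ = sym (trans (cong₂ _xor_ (xor-identityʳ (G x y)) (∧-zeroʳ _)) (xor-identityʳ (G x y)))
  ... | yes refl | yes refl
    rewrite IsSimple.loopless S a | IsSimple.loopless S b | IsSimple.symm S b a
          | xor-identityʳ (G a b) | ∧-identityʳ (G a b) = sym (xor-same (G a b))
  ... | yes refl | no _ with y ≟ b
  ...   | yes refl rewrite IsSimple.loopless S b | xor-identityʳ (G a b) | ∧-zeroʳ (G a b) =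
    sym (xor-identityʳ (G a b))
  ...   | no _ rewrite ∨-identityʳ (G y b) | IsSimple.symm S b y | ∧-zeroʳ (G a b xor G b b) =
    trans (if-not≡xor (G y b) (G a y)) (sym (xor-identityʳ _))
  slide≡addCols∘addRows {G} S x y | no _ | yes refl with x ≟ b
  ...   | yes refl rewrite IsSimple.loopless S b = sym (trans (xor-identityʳ _) (xor-identityʳ _))
  ...   | no _ rewrite xor-identityʳ (G x a) | xor-identityʳ (G x b) | ∧-identityʳ (G x b) =
    if-not≡xor (G x b) (G x a)

  corankInduced-toggle : ∀ (H : Adj n) {U} → U a ≡ false ⊎ U b ≡ false →
                         corankInduced (toggle a b H) U ≡ corankInduced H U
  corankInduced-toggle H {U} (inj₁ a∉U) = corankInduced-cong {H = toggle a b H} U λ x y x∈U y∈U →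
    toggle-unchanged {H = H} (λ (x≡a , _) → ∈-∉-≢ x∈U a∉U x≡a) (λ (_ , y≡a) → ∈-∉-≢ y∈U a∉U y≡a)
  corankInduced-toggle H {U} (inj₂ b∉U) = corankInduced-cong {H = toggle a b H} U λ x y x∈U y∈U →
    toggle-unchanged {H = H} (λ (_ , y≡b) → ∈-∉-≢ y∈U b∉U y≡b) (λ (x≡b , _) → ∈-∉-≢ x∈U b∉U x≡b)

  corankInduced-slide : a ≢ b → ∀ {G : Adj n} → IsSimple G → ∀ {U} → U a ≡ true → U b ≡ true →
                        corankInduced (slide a b G) U ≡ corankInduced G U
  corankInduced-slide a≢b {G} S {U} Ua Ub with vertexAt-onto U Ub
  ... | β , refl = begin
    corankInduced (slide a b G) U
      ≡⟨ corank-cong (λ i j → slide≡addCols∘addRows S (vertexAt U i) (vertexAt U j)) ⟩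
    corank k (addCols c β (addRows c β M)) ≡⟨ corank-addCols cβ (addRows c β M) ⟩
    corank k (addRows c β M)               ≡⟨ corank-addRows cβ M ⟩
    corankInduced G U                      ∎
    where
    open ≡-Reasoning
    k : ℕ
    k = length (elems U)
    M : Fin k → Row k
    M = inducedMatrix G U
    c : Fin k → Bool
    c i = vertexAt U i == a
    cβ : c β ≡ false
    cβ = ==-≢ (λ b≡a → a≢b (sym b≡a))

-- Four-term relations

FourTerm : ∀ {A : Set} → A → A → A → A → Set
FourTerm w x y z = (w ≡ y × x ≡ z) ⊎ (w ≡ x × y ≡ z)

FourTerm-map : ∀ {A B : Set} (f : A → B) {w x y z} → FourTerm w x y z → FourTerm (f w) (f x) (f y) (f z)
FourTerm-map f = ⊎-map (×-map (cong f) (cong f)) (×-map (cong f) (cong f))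

corankInduced-fourTerm : ∀ {n} {G : Adj n} → IsSimple G → ∀ {a b} → a ≢ b → ∀ U →
  FourTerm (corankInduced G U) (corankInduced (toggle a b G) U)
           (corankInduced (slide a b G) U) (corankInduced (slideToggle a b G) U)
corankInduced-fourTerm {G = G} S {a} {b} a≢b U with U a in Ua | U b in Ub
... | true | true = inj₁
  ( sym (corankInduced-slide a≢b S Ua Ub)
  , trans (sym (corankInduced-slide a≢b (toggle-simple a≢b S) Ua Ub))
          (corankInduced-cong U (λ x y _ _ → slide-toggle-comm G x y)) )
... | false | _     =
  inj₂ (sym (corankInduced-toggle G (inj₁ Ua)) , sym (corankInduced-toggle (slide a b G) (inj₁ Ua)))
... | true  | false =
  inj₂ (sym (corankInduced-toggle G (inj₂ Ub)) , sym (corankInduced-toggle (slide a b G) (inj₂ Ub)))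

indicator : Bool → ℕ
indicator true  = 1
indicator false = 0

count : ∀ {X : Set} → (X → Bool) → List X → ℕ
count p xs = length (filter (λ x → p x Boolᵖ.≟ true) xs)

count-∷ : ∀ {X : Set} (p : X → Bool) x xs → count p (x ∷ xs) ≡ indicator (p x) + count p xs
count-∷ p x xs with p x
... | true  = refl
... | false = refl

indicator-fourTerm : ∀ {w x y z} → FourTerm w x y z → indicator w + indicator z ≡ indicator y + indicator x
indicator-fourTerm (inj₁ (refl , refl)) = refl
indicator-fourTerm {x = x} {y} (inj₂ (refl , refl)) = +-comm (indicator x) (indicator y)

count-fourTerm-+ : ∀ {X : Set} {p q r s : X → Bool} → (∀ x → FourTerm (p x) (q x) (r x) (s x)) →
                   ∀ xs → count p xs + count s xs ≡ count r xs + count q xs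
count-fourTerm-+ h [] = refl
count-fourTerm-+ {p = p} {q} {r} {s} h (x ∷ xs) = begin
  count p (x ∷ xs) + count s (x ∷ xs)
    ≡⟨ cong₂ _+_ (count-∷ p x xs) (count-∷ s x xs) ⟩
  (indicator (p x) + count p xs) + (indicator (s x) + count s xs)
    ≡⟨ interchange (indicator (p x)) (count p xs) (indicator (s x)) (count s xs) ⟩
  (indicator (p x) + indicator (s x)) + (count p xs + count s xs)
    ≡⟨ cong₂ _+_ (indicator-fourTerm (h x)) (count-fourTerm-+ h xs) ⟩
  (indicator (r x) + indicator (q x)) + (count r xs + count q xs)
    ≡⟨ interchange (indicator (r x)) (indicator (q x)) (count r xs) (count q xs) ⟩
  (indicator (r x) + count r xs) + (indicator (q x) + count q xs)
    ≡⟨ sym (cong₂ _+_ (count-∷ r x xs) (count-∷ q x xs)) ⟩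
  count r (x ∷ xs) + count q (x ∷ xs) ∎
  where open ≡-Reasoning

+-≡⇒-≡ : ∀ {w x y z} → w + z ≡ y + x → + w - + x ≡ + y - + z
+-≡⇒-≡ {w} {x} {y} {z} w+z≡y+x = begin
  + w - + x          ≡⟨ m-n≡m⊖n w x ⟩
  w ⊖ x              ≡⟨ sym (+-cancelˡ-⊖ z w x) ⟩
  (z + w) ⊖ (z + x)  ≡⟨ cong₂ _⊖_ (trans (+-comm z w) (trans w+z≡y+x (+-comm y x))) (+-comm z x) ⟩
  (x + y) ⊖ (x + z)  ≡⟨ +-cancelˡ-⊖ x y z ⟩
  y ⊖ z              ≡⟨ sym (m-n≡m⊖n y z) ⟩
  + y - + z          ∎
  where open ≡-Reasoning

count-fourTerm : ∀ {X : Set} (p q r s : X → Bool) → (∀ x → FourTerm (p x) (q x) (r x) (s x)) →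
                 ∀ xs → + count p xs - + count q xs ≡ + count r xs - + count s xs
count-fourTerm p q r s h xs =
  +-≡⇒-≡ {count p xs} {count q xs} {count r xs} {count s xs} (count-fourTerm-+ h xs)

mainTheorem10 : (n : ℕ) (G : Adj n) → IsSimple G → (a b : Fin n) → a ≢ b →
  ∀ i j → Qbar G i j - Qbar (toggle a b G) i j
        ≡ Qbar (slide a b G) i j - Qbar (slideToggle a b G) i j
mainTheorem10 n G S a b a≢b i j =
  count-fourTerm (term G) (term (toggle a b G)) (term (slide a b G)) (term (slideToggle a b G))
    (λ U → FourTerm-map (contributes U) (corankInduced-fourTerm S a≢b U)) (subsets n)
  where
  contributes : (Fin n → Bool) → ℕ → Bool
  contributes U c = ((n ∸ length (elems U)) ≡ᵇ i) ∧ (c ≡ᵇ j)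
  term : Adj n → (Fin n → Bool) → Bool
  term H U = contributes U (corankInduced H U)
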